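{- Let $A_0(x), A_1(x), \dots, A_{p-1}(x) \in \mathbb{R}[[x]]$ be formal power series such that the sequence $(A_0(x)\, A_1(x)\, \cdots\, A_{p-1}(x))^\top$ is fully interlacing. Then the sequence $(A_1(x)\, \cdots\, A_{p-1}(x)\ \, xA_0(x))^\top$ is also fully interlacing.
   Context: A $\mathbb{Z}\times\mathbb{Z}$ real matrix is totally positive (TP) if every finite square submatrix has nonnegative determinant. For a $p\times q$ matrix $\mathcal{A} = (A_{ij}(x))_{0\le i<p,\,0\le j<q}$ of formal power series $A_{ij}(x) = \sum_{n\ge 0} a_{ij}(n)x^n \in \mathbb{R}[[x]]$ (with $a_{ij}(n) = 0$ for $n<0$), the matrix $\mathrm{Lace}(\mathcal{A}) = (M_{uv})_{u,v\in\mathbb{Z}}$ is defined as follows: for $(u,v)\in\mathbb{Z}\times\mathbb{Z}$ write uniquely $u = pu'+i$, $v = qv'+j$ with $u',v'\in\mathbb{Z}$, $0\le i<p$, $0\le j<q$, and set $M_{uv} = a_{ij}(v'-u')$ (the coefficient of $x^{v'-u'}$ in $A_{ij}(x)$). The matrix $\mathcal{A}$ is called fully interlacing if $\mathrm{Lace}(\mathcal{A})$ is TP. A sequence of power series is regarded as a column matrix ($p\times 1$), and is fully interlacing if that column matrix is. -}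

module Defs where

open import Level using (Level; _⊔_; suc)
open import Algebra.Bundles using (CommutativeRing)
open import Relation.Binary.Core using (Rel)
open import Relation.Binary.Structures using (IsTotalOrder)
open import Data.Nat as ℕ using (ℕ; zero; NonZero)
import Data.Nat.Properties as ℕP
open import Data.Integer as ℤ using (ℤ; +_; -[1+_])
open import Data.Integer.DivMod using (_/ℕ_; _%ℕ_; n%ℕd<d)
open import Data.Fin as Fin using (Fin; toℕ; fromℕ<)
open import Relation.Nullary using (yes; no)

-- An ordered commutative ring (the real numbers ℝ being the intended model):
-- a commutative ring with a total order compatible with + and *.
record OrderedCommRing (c ℓ₁ ℓ₂ : Level) : Set (Level.suc (c ⊔ ℓ₁ ⊔ ℓ₂)) where
  field
    commRing : CommutativeRing c ℓ₁
  open CommutativeRing commRing public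
  field
    _≤_ : Rel Carrier ℓ₂
    isTotalOrder : IsTotalOrder _≈_ _≤_
    +-mono-≤ : ∀ {a b} c → a ≤ b → (a + c) ≤ (b + c)
    *-nonneg : ∀ {a b} → 0# ≤ a → 0# ≤ b → 0# ≤ (a * b)

module _ {c ℓ₁ ℓ₂} (R : OrderedCommRing c ℓ₁ ℓ₂) where
  open OrderedCommRing R

  PowerSeries : Set c
  PowerSeries = ℕ → Carrier

  coeff : PowerSeries → ℤ → Carrier
  coeff A (+ n)    = A n
  coeff A -[1+ n ] = 0#

  xTimes : PowerSeries → PowerSeries
  xTimes A zero      = 0#
  xTimes A (ℕ.suc n) = A n

  Lace : (p q : ℕ) .{{_ : NonZero p}} .{{_ : NonZero q}} →
         (Fin p → Fin q → PowerSeries) → ℤ → ℤ → Carrier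
  Lace p q 𝒜 u v =
    coeff (𝒜 (fromℕ< (n%ℕd<d u p)) (fromℕ< (n%ℕd<d v q)))
          ((v /ℕ q) ℤ.- (u /ℕ p))

  sumFin : (n : ℕ) → (Fin n → Carrier) → Carrier
  sumFin zero      f = 0#
  sumFin (ℕ.suc n) f = f Fin.zero + sumFin n (λ j → f (Fin.suc j))

  signed : ℕ → Carrier → Carrier
  signed zero      a = a
  signed (ℕ.suc n) a = - signed n a

  det : (k : ℕ) → (Fin k → Fin k → Carrier) → Carrier
  det zero      M = 1#
  det (ℕ.suc k) M =
    sumFin (ℕ.suc k) (λ j →
      signed (toℕ j) (M Fin.zero j * det k (λ i l → M (Fin.suc i) (Fin.punchIn j l))))

  StrictlyIncreasing : {k : ℕ} → (Fin k → ℤ) → Set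
  StrictlyIncreasing {k} r = ∀ (i j : Fin k) → i Fin.< j → r i ℤ.< r j

  TotallyPositive : (ℤ → ℤ → Carrier) → Set ℓ₂
  TotallyPositive M = ∀ (k : ℕ) (r s : Fin k → ℤ) →
    StrictlyIncreasing r → StrictlyIncreasing s →
    0# ≤ det k (λ i j → M (r i) (s j))

  FullyInterlacing : (p q : ℕ) .{{_ : NonZero p}} .{{_ : NonZero q}} →
                     (Fin p → Fin q → PowerSeries) → Set ℓ₂
  FullyInterlacing p q 𝒜 = TotallyPositive (Lace p q 𝒜)

  column : {p : ℕ} → (Fin p → PowerSeries) → Fin p → Fin 1 → PowerSeries
  column A i _ = A i

  FullyInterlacingSeq : (p : ℕ) .{{_ : NonZero p}} → (Fin p → PowerSeries) → Set ℓ₂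
  FullyInterlacingSeq p A = FullyInterlacing p 1 (column A)

  -- (A₀,…,A_{p-1}) ↦ (A₁,…,A_{p-1}, x A₀)
  shiftSeq : (p : ℕ) → (Fin (ℕ.suc p) → PowerSeries) → Fin (ℕ.suc p) → PowerSeries
  shiftSeq p A i with ℕ.suc (toℕ i) ℕ.<? ℕ.suc p
  ... | yes lt = A (fromℕ< lt)
  ... | no _   = xTimes (A Fin.zero)

{-# OPTIONS --safe #-}
module Submission where

-- Row u of Lace (A₁, …, A_{p-1}, x A₀) is row u + 1 of Lace (A₀, …, A_{p-1}): inside a block of p
-- rows this is the relabelling of the series, and from the last row of a block, row u + 1 is the
-- first row of the next block, whose exponent shift by one is exactly the factor x.  So the square
-- submatrix on rows r₀ < … < r_{k-1} of the new matrix is the one on rows r₀ + 1 < … < r_{k-1} + 1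
-- of the old matrix, and total positivity is inherited.

open import Defs
open import Level using (Level)
open import Data.Nat using (ℕ; suc)
open import Data.Fin using (Fin)

open import Data.Empty using (⊥-elim)
open import Data.Fin as Fin using (toℕ; fromℕ<)
import Data.Fin.Properties as Fin
open import Data.Integer as ℤ using (ℤ; +_; 1ℤ; _+_; _-_; _*_; _≤_; _<_)
import Data.Integer.Properties as ℤ
open import Data.Integer.DivMod
  using (_/ℕ_; _%ℕ_; n%ℕd<d; a≡a%ℕn+[a/ℕn]*n; [n/ℕd]*d≤n; n<s[n/ℕd]*d)
import Data.Nat as ℕ
import Data.Nat.Properties as ℕ
open import Data.Product using (_×_; _,_)
open import Function using (id)
open import Relation.Binary.Core using (_Preserves_⟶_)
open import Relation.Binary.PropositionalEquality
open import Relation.Nullary using (yes; no)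
open import Algebra.Properties.AbelianGroup ℤ.+-0-abelianGroup using (∙-cancelʳ)

floor-bounds : ∀ {u q : ℤ} {r d : ℕ} → r ℕ.< d → u ≡ + r + q * + d →
               q * + d ≤ u × u < ℤ.suc q * + d
floor-bounds {q = q} {r} {d} r<d refl =
  ℤ.i≤j+i (q * + d) (+ r) ,
  (begin-strict
    + r + q * + d   <⟨ ℤ.+-monoˡ-< (q * + d) (ℤ.+<+ r<d) ⟩
    + d + q * + d   ≡⟨ ℤ.suc-* q (+ d) ⟨
    ℤ.suc q * + d   ∎)
  where open ℤ.≤-Reasoning

floor-bounds⇒≤ : ∀ {u} a b (d : ℕ) → a * + d ≤ u → u < ℤ.suc b * + d → a ≤ b
floor-bounds⇒≤ a b d ad≤u u<[1+b]d =
  subst (a ≤_) (ℤ.pred-suc b)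
        (ℤ.i<j⇒i≤pred[j] (ℤ.*-cancelʳ-<-nonNeg {a} {ℤ.suc b} (+ d) (ℤ.≤-<-trans ad≤u u<[1+b]d)))

/ℕ-unique : ∀ u d .{{_ : ℕ.NonZero d}} {r q} → r ℕ.< d → u ≡ + r + q * + d → u /ℕ d ≡ q
/ℕ-unique u d {q = q} r<d u≡r+qd with floor-bounds {q = q} r<d u≡r+qd
... | qd≤u , u<[1+q]d =
  ℤ.≤-antisym (floor-bounds⇒≤ (u /ℕ d) q d ([n/ℕd]*d≤n u d) u<[1+q]d)
              (floor-bounds⇒≤ q (u /ℕ d) d qd≤u (n<s[n/ℕd]*d u d))

%ℕ-unique : ∀ u d .{{_ : ℕ.NonZero d}} {r q} → r ℕ.< d → u ≡ + r + q * + d → u %ℕ d ≡ r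
%ℕ-unique u d {r} {q} r<d u≡r+qd = ℤ.+-injective (∙-cancelʳ (q * + d) _ _ (begin
  + (u %ℕ d) + q * + d          ≡⟨ cong (λ t → + (u %ℕ d) + t * + d) (/ℕ-unique u d {q = q} r<d u≡r+qd) ⟨
  + (u %ℕ d) + u /ℕ d * + d     ≡⟨ a≡a%ℕn+[a/ℕn]*n u d ⟨
  u                             ≡⟨ u≡r+qd ⟩
  + r + q * + d                 ∎))
  where open ≡-Reasoning

suc-+ : ∀ r x → ℤ.suc (+ r + x) ≡ + suc r + x
suc-+ r x = sym (ℤ.+-assoc 1ℤ (+ r) x)

suc-+-carry : ∀ n Q → ℤ.suc (+ n + Q * + suc n) ≡ + 0 + ℤ.suc Q * + suc n
suc-+-carry n Q = begin
  ℤ.suc (+ n + Q * + suc n)    ≡⟨ suc-+ n (Q * + suc n) ⟩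
  + suc n + Q * + suc n        ≡⟨ ℤ.suc-* Q (+ suc n) ⟨
  ℤ.suc Q * + suc n            ≡⟨ ℤ.+-identityˡ _ ⟨
  + 0 + ℤ.suc Q * + suc n      ∎
  where open ≡-Reasoning

i-suc[j]≡i-j-1 : ∀ i j → i - ℤ.suc j ≡ (i - j) - 1ℤ
i-suc[j]≡i-j-1 i j = begin
  i + ℤ.- (1ℤ + j)             ≡⟨ cong (_+_ i) (ℤ.neg-distrib-+ 1ℤ j) ⟩
  i + (ℤ.- 1ℤ + ℤ.- j)         ≡⟨ cong (_+_ i) (ℤ.+-comm (ℤ.- 1ℤ) (ℤ.- j)) ⟩
  i + (ℤ.- j + ℤ.- 1ℤ)         ≡⟨ ℤ.+-assoc i (ℤ.- j) (ℤ.- 1ℤ) ⟨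
  (i - j) - 1ℤ                 ∎
  where open ≡-Reasoning

module _ {c ℓ₁ ℓ₂ : Level} (R : OrderedCommRing c ℓ₁ ℓ₂) where
  open OrderedCommRing R using (Carrier; 0#) renaming (_+_ to _⊕_; _*_ to _⊛_; _≤_ to _≼_)

  sumFin-cong : ∀ k {f g : Fin k → Carrier} → (∀ j → f j ≡ g j) → sumFin R k f ≡ sumFin R k g
  sumFin-cong ℕ.zero    f≡g = refl
  sumFin-cong (suc k) f≡g = cong₂ _⊕_ (f≡g Fin.zero) (sumFin-cong k (λ j → f≡g (Fin.suc j)))

  det-cong : ∀ k {M N : Fin k → Fin k → Carrier} → (∀ i j → M i j ≡ N i j) → det R k M ≡ det R k N
  det-cong ℕ.zero    M≡N = refl
  det-cong (suc k) M≡N = sumFin-cong (suc k) λ j →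
    cong (signed R (toℕ j))
         (cong₂ _⊛_ (M≡N Fin.zero j) (det-cong k λ i l → M≡N (Fin.suc i) (Fin.punchIn j l)))

  TotallyPositive-cong : ∀ {M N : ℤ → ℤ → Carrier} → (∀ u v → M u v ≡ N u v) →
                         TotallyPositive R M → TotallyPositive R N
  TotallyPositive-cong M≡N tpM k r s r↑ s↑ =
    subst (0# ≼_) (det-cong k λ i j → M≡N (r i) (s j)) (tpM k r s r↑ s↑)

  TotallyPositive-reindex : ∀ {M : ℤ → ℤ → Carrier} {f g : ℤ → ℤ} →
                            f Preserves _<_ ⟶ _<_ → g Preserves _<_ ⟶ _<_ →
                            TotallyPositive R M → TotallyPositive R (λ u v → M (f u) (g v))
  TotallyPositive-reindex f↑ g↑ tpM k r s r↑ s↑ =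
    tpM k _ _ (λ i j i<j → f↑ (r↑ i j i<j)) (λ i j i<j → g↑ (s↑ i j i<j))

  coeff-xTimes : ∀ A z → coeff R (xTimes R A) z ≡ coeff R A (z - 1ℤ)
  coeff-xTimes A (+ ℕ.zero)  = refl
  coeff-xTimes A (+ suc m)   = refl
  coeff-xTimes A ℤ.-[1+ m ]  = refl

  module _ (n : ℕ) (A : Fin (suc n) → PowerSeries R) where
    shiftSeq-< : ∀ {r} (r<1+n : r ℕ.< suc n) (1+r<1+n : suc r ℕ.< suc n) →
                 shiftSeq R n A (fromℕ< r<1+n) ≡ A (fromℕ< 1+r<1+n)
    shiftSeq-< r<1+n 1+r<1+n with suc (toℕ (fromℕ< r<1+n)) ℕ.<? suc n
    ... | yes lt = cong A (Fin.fromℕ<-cong _ _ (cong suc (Fin.toℕ-fromℕ< r<1+n)) lt 1+r<1+n)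
    ... | no ≮ = ⊥-elim (≮ (subst (λ t → suc t ℕ.< suc n) (sym (Fin.toℕ-fromℕ< r<1+n)) 1+r<1+n))

    shiftSeq-last : ∀ {r} (r<1+n : r ℕ.< suc n) → r ≡ n →
                    shiftSeq R n A (fromℕ< r<1+n) ≡ xTimes R (A Fin.zero)
    shiftSeq-last r<1+n r≡n with suc (toℕ (fromℕ< r<1+n)) ℕ.<? suc n
    ... | yes lt = ⊥-elim (ℕ.<-irrefl (cong suc (trans (Fin.toℕ-fromℕ< r<1+n) r≡n)) lt)
    ... | no _  = refl

  Lace-at : ∀ p q .{{_ : ℕ.NonZero p}} .{{_ : ℕ.NonZero q}} (𝒜 : Fin p → Fin q → PowerSeries R)
            {r Q} (r<p : r ℕ.< p) u v → u ≡ + r + Q * + p →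
            Lace R p q 𝒜 u v ≡ coeff R (𝒜 (fromℕ< r<p) (fromℕ< (n%ℕd<d v q))) (v /ℕ q - Q)
  Lace-at p q 𝒜 {Q = Q} r<p u v u≡r+Qp =
    cong₂ (λ i Q′ → coeff R (𝒜 i (fromℕ< (n%ℕd<d v q))) (v /ℕ q - Q′))
          (Fin.fromℕ<-cong _ _ (%ℕ-unique u p {q = Q} r<p u≡r+Qp) (n%ℕd<d u p) r<p)
          (/ℕ-unique u p {q = Q} r<p u≡r+Qp)

  shiftRows : ∀ n q → (Fin (suc n) → Fin q → PowerSeries R) → Fin (suc n) → Fin q → PowerSeries R
  shiftRows n q 𝒜 i j = shiftSeq R n (λ i′ → 𝒜 i′ j) i

  module _ (n q : ℕ) .{{_ : ℕ.NonZero q}} (𝒜 : Fin (suc n) → Fin q → PowerSeries R) (u v : ℤ) where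
    private
      r = u %ℕ suc n
      Q = u /ℕ suc n
      r<1+n = n%ℕd<d u (suc n)
      u≡r+Qp = a≡a%ℕn+[a/ℕn]*n u (suc n)
      w = v /ℕ q
      j = fromℕ< (n%ℕd<d v q)
      column-j = λ i → 𝒜 i j

    Lace-shiftRows : Lace R (suc n) q (shiftRows n q 𝒜) u v ≡ Lace R (suc n) q 𝒜 (ℤ.suc u) v
    Lace-shiftRows with suc r ℕ.<? suc n
    ... | yes 1+r<1+n = begin
      coeff R (shiftSeq R n column-j (fromℕ< r<1+n)) (w - Q)
        ≡⟨ cong (λ B → coeff R B (w - Q)) (shiftSeq-< n column-j r<1+n 1+r<1+n) ⟩
      coeff R (𝒜 (fromℕ< 1+r<1+n) j) (w - Q)
        ≡⟨ Lace-at (suc n) q 𝒜 1+r<1+n (ℤ.suc u) v u+1≡[r+1]+Qp ⟨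
      Lace R (suc n) q 𝒜 (ℤ.suc u) v ∎
      where
      open ≡-Reasoning
      u+1≡[r+1]+Qp : ℤ.suc u ≡ + suc r + Q * + suc n
      u+1≡[r+1]+Qp = trans (cong ℤ.suc u≡r+Qp) (suc-+ r (Q * + suc n))
    ... | no 1+r≮1+n = begin
      coeff R (shiftSeq R n column-j (fromℕ< r<1+n)) (w - Q)
        ≡⟨ cong (λ B → coeff R B (w - Q)) (shiftSeq-last n column-j r<1+n r≡n) ⟩
      coeff R (xTimes R (𝒜 Fin.zero j)) (w - Q)
        ≡⟨ coeff-xTimes (𝒜 Fin.zero j) (w - Q) ⟩
      coeff R (𝒜 Fin.zero j) ((w - Q) - 1ℤ)
        ≡⟨ cong (coeff R _) (i-suc[j]≡i-j-1 w Q) ⟨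
      coeff R (𝒜 Fin.zero j) (w - ℤ.suc Q)
        ≡⟨ Lace-at (suc n) q 𝒜 ℕ.z<s (ℤ.suc u) v u+1≡0+[Q+1]p ⟨
      Lace R (suc n) q 𝒜 (ℤ.suc u) v ∎
      where
      open ≡-Reasoning
      r≡n : r ≡ n
      r≡n = ℕ.≤-antisym (ℕ.s≤s⁻¹ r<1+n) (ℕ.s≤s⁻¹ (ℕ.≮⇒≥ 1+r≮1+n))
      u+1≡0+[Q+1]p : ℤ.suc u ≡ + 0 + ℤ.suc Q * + suc n
      u+1≡0+[Q+1]p = trans (cong ℤ.suc (subst (λ t → u ≡ + t + Q * + suc n) r≡n u≡r+Qp))
                           (suc-+-carry n Q)

lemma3p1 : ∀ {c ℓ₁ ℓ₂ : Level} (R : OrderedCommRing c ℓ₁ ℓ₂) (n : ℕ)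
             (A : Fin (suc n) → PowerSeries R) →
             FullyInterlacingSeq R (suc n) A →
             FullyInterlacingSeq R (suc n) (shiftSeq R n A)
lemma3p1 R n A A-interlacing =
  TotallyPositive-cong R (λ u v → sym (Lace-shiftRows R n 1 (column R A) u v))
    (TotallyPositive-reindex R {M = Lace R (suc n) 1 (column R A)} (ℤ.+-monoʳ-< 1ℤ) id A-interlacing)
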